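{- (a) No minimal DSF triple contains a graph with one or two vertices. (b) No minimal DSF triple contains $P_3$ or $K_1+K_2$.
   Context: All graphs are finite and simple, considered up to isomorphism. $P_n$ is the path on $n$ vertices, $K_n$ the complete graph on $n$ vertices, and $G+H$ the disjoint union. For a set $\mathcal{F}$ of graphs, a graph is $\mathcal{F}$-free if none of its induced subgraphs is isomorphic to a member of $\mathcal{F}$. A set $\mathcal{F}$ of graphs is degree-sequence-forcing (DSF) if whenever some realization of a degree sequence $d$ (a graph with degree sequence $d$) is $\mathcal{F}$-free, every realization of $d$ is $\mathcal{F}$-free. A DSF set is minimal if no proper subset of it is DSF; a minimal DSF triple is a minimal DSF set with exactly three elements. -}

module Defs where

open import Data.Nat using (ℕ; zero; suc)
open import Data.Bool using (Bool; true; false; if_then_else_)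
open import Data.Fin using (Fin; zero; suc)
open import Data.List using (List; []; _∷_; map; allFin)
open import Data.Nat.ListAction using (sum)
open import Data.List.Relation.Unary.All using (All)
open import Data.List.Relation.Unary.Any using (Any)
open import Data.List.Relation.Binary.Permutation.Propositional using (_↭_)
open import Data.Product using (Σ; _×_)
open import Relation.Binary.PropositionalEquality using (_≡_; refl)
open import Relation.Nullary using (¬_)
open import Function.Definitions using (Injective)

record Graph : Set where
  field
    order  : ℕ
    adj    : Fin order → Fin order → Bool
    sym    : ∀ i j → adj i j ≡ adj j i
    irrefl : ∀ i → adj i i ≡ false
open Graph public

record _≅_ (G H : Graph) : Set where
  field
    to      : Fin (order G) → Fin (order H)
    from    : Fin (order H) → Fin (order G)
    from∘to : ∀ i → from (to i) ≡ i
    to∘from : ∀ j → to (from j) ≡ j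
    preserves : ∀ i j → adj H (to i) (to j) ≡ adj G i j

record InducedIn (H G : Graph) : Set where
  field
    emb      : Fin (order H) → Fin (order G)
    emb-inj  : Injective _≡_ _≡_ emb
    emb-adj  : ∀ i j → adj G (emb i) (emb j) ≡ adj H i j

degree : (G : Graph) → Fin (order G) → ℕ
degree G i = sum (map (λ j → if adj G i j then 1 else 0) (allFin (order G)))

degSeq : Graph → List ℕ
degSeq G = map (degree G) (allFin (order G))

SameDegSeq : Graph → Graph → Set
SameDegSeq G G' = degSeq G ↭ degSeq G'

Free : List Graph → Graph → Set
Free F G = All (λ H → ¬ InducedIn H G) F

DSF : List Graph → Set
DSF F = ∀ G G' → SameDegSeq G G' → Free F G → Free F G'

MinimalDSFTriple : Graph → Graph → Graph → Set
MinimalDSFTriple F₁ F₂ F₃ =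
  (¬ (F₁ ≅ F₂)) × (¬ (F₁ ≅ F₃)) × (¬ (F₂ ≅ F₃)) ×
  DSF (F₁ ∷ F₂ ∷ F₃ ∷ []) ×
  (¬ DSF (F₁ ∷ [])) × (¬ DSF (F₂ ∷ [])) × (¬ DSF (F₃ ∷ [])) ×
  (¬ DSF (F₁ ∷ F₂ ∷ [])) × (¬ DSF (F₁ ∷ F₃ ∷ [])) × (¬ DSF (F₂ ∷ F₃ ∷ []))

P3-adj : Fin 3 → Fin 3 → Bool
P3-adj zero (suc zero) = true
P3-adj (suc zero) zero = true
P3-adj (suc zero) (suc (suc zero)) = true
P3-adj (suc (suc zero)) (suc zero) = true
P3-adj _ _ = false

P3 : Graph
P3 = record { order = 3 ; adj = P3-adj ; sym = s ; irrefl = r }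
  where
  s : ∀ i j → P3-adj i j ≡ P3-adj j i
  s zero zero = refl
  s zero (suc zero) = refl
  s zero (suc (suc zero)) = refl
  s (suc zero) zero = refl
  s (suc zero) (suc zero) = refl
  s (suc zero) (suc (suc zero)) = refl
  s (suc (suc zero)) zero = refl
  s (suc (suc zero)) (suc zero) = refl
  s (suc (suc zero)) (suc (suc zero)) = refl
  r : ∀ i → P3-adj i i ≡ false
  r zero = refl
  r (suc zero) = refl
  r (suc (suc zero)) = refl

K1+K2-adj : Fin 3 → Fin 3 → Bool
K1+K2-adj (suc zero) (suc (suc zero)) = true
K1+K2-adj (suc (suc zero)) (suc zero) = true
K1+K2-adj _ _ = false

K1+K2 : Graph
K1+K2 = record { order = 3 ; adj = K1+K2-adj ; sym = s ; irrefl = r }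
  where
  s : ∀ i j → K1+K2-adj i j ≡ K1+K2-adj j i
  s zero zero = refl
  s zero (suc zero) = refl
  s zero (suc (suc zero)) = refl
  s (suc zero) zero = refl
  s (suc zero) (suc zero) = refl
  s (suc zero) (suc (suc zero)) = refl
  s (suc (suc zero)) zero = refl
  s (suc (suc zero)) (suc zero) = refl
  s (suc (suc zero)) (suc (suc zero)) = refl
  r : ∀ i → K1+K2-adj i i ≡ false
  r zero = refl
  r (suc zero) = refl
  r (suc (suc zero)) = refl

-- (a) A graph contains the one-vertex graph iff it has a vertex, and contains a two-vertex graph
-- with an edge iff it has an edge; both are properties of the degree sequence, and the edgeless
-- two-vertex graph reduces to the latter by complementation. So {H} alone is already DSF.
--
-- (b) Let {P3, A, B} be DSF. K3 + K2 and P5 have the same degree sequence and only P5 contains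
-- P3, so A or B, say A, is an induced subgraph of K3 + K2. Then {P3, A} is already DSF. A
-- {P3, A}-free graph G is a disjoint union of cliques without induced K3 + K2, so either its
-- non-isolated vertices form a single clique, a property of the degree sequence that determines
-- G up to isomorphism, or G has maximum degree 1 and contains 2K2. In the second case every
-- realization G' of the same sequence has maximum degree 1, hence is P3-free, and an induced A
-- in G' has maximum degree 1, so it embeds in 2K2 and therefore in G. Complementation preserves
-- DSF sets and turns K1 + K2 into P3, which settles K1 + K2.

module Submission where

open import Defs renaming (sym to adj-sym)

open import Data.Bool using (Bool; true; false; not; _∧_; _∨_; if_then_else_)
import Data.Bool as Bool
open import Data.Bool.Properties using (∨-comm; not-involutive)
open import Data.Empty using (⊥; ⊥-elim)
open import Data.Fin using (Fin; zero; suc; toℕ; cast; splitAt; join; _↑ˡ_; punchIn; punchOut)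
open import Data.Fin.Permutation using (Permutation; _⟨$⟩ʳ_; _⟨$⟩ˡ_; _∘ₚ_; cast-id; inverseˡ; inverseʳ; ↔⇒≡)
open import Data.Fin.Properties
  using (_≟_; all?; any?; cast-involutive; join-splitAt; punchIn-punchOut; punchOut-injective)
open import Data.Fin.Subset using (Subset; _∈_; _∉_; _⊆_; ∣_∣; _-_; ⁅_⁆; ∁; inside; outside)
open import Data.Fin.Subset.Properties
  using (x∈p⇒∣p-x∣<∣p∣; x∈p∧x≢y⇒x∈p-y; p─q─q≡p─q; p─⊥≡p; p─q⊆p; p⊆q⇒∣p∣≤∣q∣; nonempty?; Empty-unique;
         ∣⊥∣≡0; x∈⁅x⁆; ∣⁅x⁆∣≡1; x∉p⇒x∈∁p; x∈∁p⇒x∉p; ∣∁p∣≡n∸∣p∣)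
open import Data.List as List using ([]; _∷_)
open import Data.List.Properties using (map-tabulate; tabulate-cong; length-tabulate; lookup-tabulate)
open import Data.List.Relation.Binary.Permutation.Propositional using (_↭_; ↭-refl; ↭-sym; swap; ↭⇒↭ₛ)
open import Data.List.Relation.Binary.Permutation.Propositional.Properties using (map⁺; shift; All-resp-↭)
import Data.List.Relation.Binary.Permutation.Setoid as Setoid↭
import Data.List.Relation.Binary.Permutation.Setoid.Properties as Setoid↭ₚ
open import Data.List.Relation.Unary.All as All using (All; []; _∷_)
import Data.List.Relation.Unary.All.Properties as All
open import Data.Nat using (ℕ; zero; suc; _+_; _∸_; pred; _≡ᵇ_; _<_; _≤_; z≤n; s≤s)
open import Data.Nat.ListAction using (sum)
open import Data.Nat.ListAction.Properties using (sum-↭)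
open import Data.Nat.Properties using (suc-injective; ≤-antisym; <-irrefl; ≤-<-trans; ≤-trans; ≤-reflexive)
open import Data.Product using (Σ; ∃; _×_; _,_; proj₁; proj₂)
open import Data.Sum using (_⊎_; inj₁; inj₂; [_,_])
open import Data.Vec as Vec using (_∷_; here; there)
open import Data.Vec.Properties using (lookup∘tabulate; []=⇒lookup; lookup⇒[]=)
open import Function using (_∘_; case_of_)
open import Function.Bundles using (Inverse)
open import Relation.Binary.PropositionalEquality
  using (_≡_; _≢_; refl; sym; trans; cong; cong₂; subst; subst₂; setoid; module ≡-Reasoning)
open import Relation.Nullary using (¬_; Dec; yes; no; does)
open import Relation.Nullary.Decidable
  using (True; toWitness; from-yes; dec-true; dec-false; decidable-stable; ¬?; _→-dec_; _⊎-dec_; _×-dec_)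

private
  variable
    A B G G' H H' : Graph

_==_ : ∀ {n} → Fin n → Fin n → Bool
i == j = does (i ≟ j)

==-sym : ∀ {n} (i j : Fin n) → (i == j) ≡ (j == i)
==-sym i j with i ≟ j | j ≟ i
... | yes _   | yes _   = refl
... | no _    | no _    = refl
... | yes i≡j | no j≢i  = ⊥-elim (j≢i (sym i≡j))
... | no i≢j  | yes j≡i = ⊥-elim (i≢j (sym j≡i))

==-refl : ∀ {n} (i : Fin n) → (i == i) ≡ true
==-refl i = dec-true (i ≟ i) refl

==-injective : ∀ {m n} {f : Fin m → Fin n} → (∀ {i j} → f i ≡ f j → i ≡ j) → ∀ i j → (f i == f j) ≡ (i == j)
==-injective {f = f} f-inj i j with i ≟ j
... | yes refl = ==-refl (f i)
... | no i≢j  = dec-false (f i ≟ f j) (i≢j ∘ f-inj)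

Fin1-unique : ∀ {n} → n ≡ 1 → (i j : Fin n) → i ≡ j
Fin1-unique refl zero zero = refl

Fin2-distinct : ∀ {n} → n ≡ 2 → ∃ λ (x : Fin n) → ∃ λ y → x ≢ y
Fin2-distinct refl = zero , suc zero , λ ()

Fin2-symmetric : ∀ {n} → n ≡ 2 → ∀ {x y : Fin n} → x ≢ y → (P : Fin n → Fin n → Set) → P x y → P y x →
                 ∀ {i j} → i ≢ j → P i j
Fin2-symmetric refl {zero}     {zero}     x≢y _ _ _ _ = ⊥-elim (x≢y refl)
Fin2-symmetric refl {suc zero} {suc zero} x≢y _ _ _ _ = ⊥-elim (x≢y refl)
Fin2-symmetric refl _ _ _ _ {zero}     {zero}     i≢j = ⊥-elim (i≢j refl)
Fin2-symmetric refl _ _ _ _ {suc zero} {suc zero} i≢j = ⊥-elim (i≢j refl)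
Fin2-symmetric refl {zero}     {suc zero} _ P Pxy Pyx {zero}     {suc zero} _ = Pxy
Fin2-symmetric refl {zero}     {suc zero} _ P Pxy Pyx {suc zero} {zero}     _ = Pyx
Fin2-symmetric refl {suc zero} {zero}     _ P Pxy Pyx {zero}     {suc zero} _ = Pyx
Fin2-symmetric refl {suc zero} {zero}     _ P Pxy Pyx {suc zero} {zero}     _ = Pxy

pair : ∀ {X : Set} → X → X → Fin 2 → X
pair a b zero       = a
pair a b (suc zero) = b

triple : ∀ {X : Set} → X → X → X → Fin 3 → X
triple a b c zero             = a
triple a b c (suc zero)       = b
triple a b c (suc (suc zero)) = c

triple-≢ : ∀ {X : Set} {a b c : X} → a ≢ b → a ≢ c → b ≢ c →
           ∀ {i j} → i ≢ j → triple a b c i ≢ triple a b c j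
triple-≢ a≢b a≢c b≢c {zero}             {suc zero}         _ = a≢b
triple-≢ a≢b a≢c b≢c {zero}             {suc (suc zero)}   _ = a≢c
triple-≢ a≢b a≢c b≢c {suc zero}         {suc (suc zero)}   _ = b≢c
triple-≢ a≢b a≢c b≢c {suc zero}         {zero}             _ = a≢b ∘ sym
triple-≢ a≢b a≢c b≢c {suc (suc zero)}   {zero}             _ = a≢c ∘ sym
triple-≢ a≢b a≢c b≢c {suc (suc zero)}   {suc zero}         _ = b≢c ∘ sym
triple-≢ a≢b a≢c b≢c {zero}             {zero}           i≢j = ⊥-elim (i≢j refl)
triple-≢ a≢b a≢c b≢c {suc zero}         {suc zero}       i≢j = ⊥-elim (i≢j refl)
triple-≢ a≢b a≢c b≢c {suc (suc zero)}   {suc (suc zero)} i≢j = ⊥-elim (i≢j refl)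

∈-tabulate⁺ : ∀ {n} (f : Fin n → Bool) {i} → f i ≡ true → i ∈ Vec.tabulate f
∈-tabulate⁺ f {i} fi = lookup⇒[]= i (Vec.tabulate f) (trans (lookup∘tabulate f i) fi)

∈-tabulate⁻ : ∀ {n} (f : Fin n → Bool) {i} → i ∈ Vec.tabulate f → f i ≡ true
∈-tabulate⁻ f {i} i∈f = trans (sym (lookup∘tabulate f i)) ([]=⇒lookup i∈f)

∣tabulate∣≡sum : ∀ {n} (f : Fin n → Bool) →
                 ∣ Vec.tabulate f ∣ ≡ sum (List.tabulate (λ j → if f j then 1 else 0))
∣tabulate∣≡sum {zero}  f = refl
∣tabulate∣≡sum {suc n} f with f zero
... | true  = cong suc (∣tabulate∣≡sum (f ∘ suc))
... | false = ∣tabulate∣≡sum (f ∘ suc)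

x∉p-x : ∀ {n} {p : Subset n} {x} → x ∉ p - x
x∉p-x {p = p} {x} x∈p-x = <-irrefl (cong ∣_∣ (p─q─q≡p─q p ⁅ x ⁆)) (x∈p⇒∣p-x∣<∣p∣ x∈p-x)

suc∣p-x∣≡∣p∣ : ∀ {n} {p : Subset n} {x} → x ∈ p → suc ∣ p - x ∣ ≡ ∣ p ∣
suc∣p-x∣≡∣p∣ {p = inside  ∷ p} here        = cong (suc ∘ ∣_∣) (p─⊥≡p p)
suc∣p-x∣≡∣p∣ {p = inside  ∷ p} (there x∈p) = cong suc (suc∣p-x∣≡∣p∣ x∈p)
suc∣p-x∣≡∣p∣ {p = outside ∷ p} (there x∈p) = suc∣p-x∣≡∣p∣ x∈p

module _ {X : Set} where
  open Setoid↭ (setoid X) using (onIndices)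
  open Setoid↭ₚ (setoid X) using (onIndices-lookup)

  tabulate-↭⇒permutation : ∀ {m n} {f : Fin m → X} {g : Fin n → X} →
    List.tabulate f ↭ List.tabulate g → Σ (Permutation m n) λ π → ∀ i → g (π ⟨$⟩ʳ i) ≡ f i
  tabulate-↭⇒permutation {f = f} {g} f↭g = π , labels
    where
    ρ = onIndices (↭⇒↭ₛ f↭g)
    π = cast-id (sym (length-tabulate f)) ∘ₚ ρ ∘ₚ cast-id (length-tabulate g)
    labels : ∀ i → g (π ⟨$⟩ʳ i) ≡ f i
    labels i = begin
      g (cast (length-tabulate g) (Inverse.to ρ k))
        ≡⟨ lookup-tabulate g _ ⟨
      List.lookup (List.tabulate g)
        (cast (sym (length-tabulate g)) (cast (length-tabulate g) (Inverse.to ρ k)))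
        ≡⟨ cong (List.lookup (List.tabulate g))
                (cast-involutive (sym (length-tabulate g)) (length-tabulate g) (Inverse.to ρ k)) ⟩
      List.lookup (List.tabulate g) (Inverse.to ρ k)
        ≡⟨ onIndices-lookup (↭⇒↭ₛ f↭g) k ⟨
      List.lookup (List.tabulate f) k
        ≡⟨ lookup-tabulate f i ⟩
      f i ∎
      where
      open ≡-Reasoning
      k = cast (sym (length-tabulate f)) i

K : ℕ → Graph
K n = record
  { order  = n
  ; adj    = λ i j → not (i == j)
  ; sym    = λ i j → cong not (==-sym i j)
  ; irrefl = λ i → cong not (==-refl i)
  }

adj⊎ : (G H : Graph) → Fin (order G) ⊎ Fin (order H) → Fin (order G) ⊎ Fin (order H) → Bool
adj⊎ G H (inj₁ i) (inj₁ j) = adj G i j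
adj⊎ G H (inj₂ i) (inj₂ j) = adj H i j
adj⊎ G H _        _        = false

_⊕_ : Graph → Graph → Graph
G ⊕ H = record
  { order  = order G + order H
  ; adj    = λ i j → adj⊎ G H (splitAt _ i) (splitAt _ j)
  ; sym    = λ i j → sym⊎ (splitAt _ i) (splitAt _ j)
  ; irrefl = λ i → irrefl⊎ (splitAt _ i)
  }
  where
  sym⊎ : ∀ x y → adj⊎ G H x y ≡ adj⊎ G H y x
  sym⊎ (inj₁ i) (inj₁ j) = adj-sym G i j
  sym⊎ (inj₁ i) (inj₂ j) = refl
  sym⊎ (inj₂ i) (inj₁ j) = refl
  sym⊎ (inj₂ i) (inj₂ j) = adj-sym H i j
  irrefl⊎ : ∀ x → adj⊎ G H x x ≡ false
  irrefl⊎ (inj₁ i) = irrefl G i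
  irrefl⊎ (inj₂ i) = irrefl H i

complement : Graph → Graph
complement G = record
  { order  = order G
  ; adj    = λ i j → not (i == j) ∧ not (adj G i j)
  ; sym    = λ i j → cong₂ _∧_ (cong not (==-sym i j)) (cong not (adj-sym G i j))
  ; irrefl = λ i → cong (λ b → not b ∧ not (adj G i i)) (==-refl i)
  }

1+n≡ᵇn≡false : ∀ m → (suc m ≡ᵇ m) ≡ false
1+n≡ᵇn≡false zero    = refl
1+n≡ᵇn≡false (suc m) = 1+n≡ᵇn≡false m

path : ℕ → Graph
path n = record
  { order  = n
  ; adj    = λ i j → (suc (toℕ i) ≡ᵇ toℕ j) ∨ (suc (toℕ j) ≡ᵇ toℕ i)
  ; sym    = λ i j → ∨-comm (suc (toℕ i) ≡ᵇ toℕ j) _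
  ; irrefl = λ i → cong (λ b → b ∨ b) (1+n≡ᵇn≡false (toℕ i))
  }

adj⇒≢ : ∀ {u v} → adj G u v ≡ true → u ≢ v
adj⇒≢ {G} {u} uv refl with () ← trans (sym uv) (irrefl G u)

mkInduced : (f : Fin (order H) → Fin (order G)) → (∀ {i j} → i ≢ j → f i ≢ f j) →
            (∀ i j → adj G (f i) (f j) ≡ adj H i j) → InducedIn H G
mkInduced f f-≢ f-adj = record
  { emb     = f
  ; emb-inj = λ {i} {j} fi≡fj → decidable-stable (i ≟ j) (λ i≢j → f-≢ i≢j fi≡fj)
  ; emb-adj = f-adj
  }

InducedIn-trans : InducedIn A B → InducedIn B G → InducedIn A G
InducedIn-trans A≤B B≤G = record
  { emb     = B.emb ∘ A.emb
  ; emb-inj = A.emb-inj ∘ B.emb-inj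
  ; emb-adj = λ i j → trans (B.emb-adj (A.emb i) (A.emb j)) (A.emb-adj i j)
  }
  where
  module A = InducedIn A≤B
  module B = InducedIn B≤G

≅⇒InducedIn : H ≅ G → InducedIn H G
≅⇒InducedIn φ = mkInduced to (λ i≢j → i≢j ∘ to-injective) preserves
  where
  open _≅_ φ
  to-injective : ∀ {i j} → to i ≡ to j → i ≡ j
  to-injective {i} {j} e = trans (sym (from∘to i)) (trans (cong from e) (from∘to j))

≅-sym : H ≅ G → G ≅ H
≅-sym {H} {G} φ = record
  { to = from ; from = to ; from∘to = to∘from ; to∘from = from∘to
  ; preserves = λ i j → trans (sym (preserves (from i) (from j))) (cong₂ (adj G) (to∘from i) (to∘from j))
  }
  where open _≅_ φ

Clique : (G : Graph) → ∀ {m} → (Fin m → Fin (order G)) → Set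
Clique G f = ∀ {i j} → i ≢ j → adj G (f i) (f j) ≡ true

Clique⇒injective : ∀ {m} {f : Fin m → Fin (order G)} → Clique G f → ∀ {i j} → f i ≡ f j → i ≡ j
Clique⇒injective {G} clique {i} {j} fi≡fj = decidable-stable (i ≟ j) (λ i≢j → adj⇒≢ {G} (clique i≢j) fi≡fj)

edge-Clique : ∀ {a b} → adj G a b ≡ true → Clique G (pair a b)
edge-Clique     ab {zero}     {zero}     i≢j = ⊥-elim (i≢j refl)
edge-Clique     ab {zero}     {suc zero} _   = ab
edge-Clique {G} ab {suc zero} {zero}     _   = trans (adj-sym G _ _) ab
edge-Clique     ab {suc zero} {suc zero} i≢j = ⊥-elim (i≢j refl)

complete-InducedIn : (∀ {i j} → i ≢ j → adj H i j ≡ true) → (f : Fin (order H) → Fin (order G)) →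
                     Clique G f → InducedIn H G
complete-InducedIn {H} {G} H-complete f f-clique = record
  { emb = f ; emb-inj = Clique⇒injective {G} f-clique ; emb-adj = f-adj }
  where
  f-adj : ∀ i j → adj G (f i) (f j) ≡ adj H i j
  f-adj i j with i ≟ j
  ... | yes refl = trans (irrefl G (f i)) (sym (irrefl H i))
  ... | no  i≢j  = trans (f-clique i≢j) (sym (H-complete i≢j))

embedding? : (H G : Graph) (f : Fin (order H) → Fin (order G)) →
  Dec ((∀ i j → f i ≡ f j → i ≡ j) × (∀ i j → adj G (f i) (f j) ≡ adj H i j))
embedding? H G f = (all? λ i → all? λ j → (f i ≟ f j) →-dec (i ≟ j))
               ×-dec (all? λ i → all? λ j → adj G (f i) (f j) Bool.≟ adj H i j)

InducedIn-by-evaluation : ∀ (f : Fin (order H) → Fin (order G)) → {True (embedding? H G f)} → InducedIn H G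
InducedIn-by-evaluation f {ok} = record
  { emb = f ; emb-inj = λ {i} {j} → proj₁ (toWitness ok) i j ; emb-adj = proj₂ (toWitness ok) }

neighbours : (G : Graph) → Fin (order G) → Subset (order G)
neighbours G i = Vec.tabulate (adj G i)

degree≡∣neighbours∣ : ∀ G i → degree G i ≡ ∣ neighbours G i ∣
degree≡∣neighbours∣ G i =
  trans (cong sum (map-tabulate (λ j → j) (λ j → if adj G i j then 1 else 0))) (sym (∣tabulate∣≡sum (adj G i)))

adj⇒0<degree : ∀ {i j} → adj G i j ≡ true → 0 < degree G i
adj⇒0<degree {G} {i} ij = subst (0 <_) (sym (degree≡∣neighbours∣ G i))
  (≤-<-trans z≤n (x∈p⇒∣p-x∣<∣p∣ (∈-tabulate⁺ (adj G i) ij)))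

degree≡0⇒¬adj : ∀ {i} j → degree G i ≡ 0 → adj G i j ≡ false
degree≡0⇒¬adj {G} {i} j d≡0 with adj G i j in ij
... | false = refl
... | true  = ⊥-elim (<-irrefl (sym d≡0) (adj⇒0<degree {G} ij))

isolated-or-adj : ∀ i → degree G i ≡ 0 ⊎ ∃ λ j → adj G i j ≡ true
isolated-or-adj {G} i with nonempty? (neighbours G i)
... | yes (j , j∈N) = inj₂ (j , ∈-tabulate⁻ (adj G i) j∈N)
... | no  N-empty   = inj₁ (trans (degree≡∣neighbours∣ G i)
                                   (trans (cong ∣_∣ (Empty-unique N-empty)) (∣⊥∣≡0 (order G))))

0<degree⇒adj : ∀ {i} → 0 < degree G i → ∃ λ j → adj G i j ≡ true
0<degree⇒adj {G} {i} 0<d with isolated-or-adj {G} i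
... | inj₁ d≡0 = ⊥-elim (<-irrefl (sym d≡0) 0<d)
... | inj₂ nbr = nbr

∉neighbours⇒¬adj : ∀ {i j} → j ∉ neighbours G i → adj G i j ≡ false
∉neighbours⇒¬adj {G} {i} {j} j∉N with adj G i j in ij
... | false = refl
... | true  = ⊥-elim (j∉N (∈-tabulate⁺ (adj G i) ij))

two-neighbours⇒2≤degree : ∀ {i j k} → adj G i j ≡ true → adj G i k ≡ true → j ≢ k → 2 ≤ degree G i
two-neighbours⇒2≤degree {G} {i} {j} {k} ij ik j≢k = subst (2 ≤_) (sym (degree≡∣neighbours∣ G i))
  (≤-<-trans (≤-<-trans z≤n (x∈p⇒∣p-x∣<∣p∣ k∈N-j)) (x∈p⇒∣p-x∣<∣p∣ (∈-tabulate⁺ (adj G i) ij)))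
  where
  k∈N-j : k ∈ neighbours G i - j
  k∈N-j = x∈p∧x≢y⇒x∈p-y (∈-tabulate⁺ (adj G i) ik) (j≢k ∘ sym)

MaxDeg1 : Graph → Set
MaxDeg1 G = ∀ {i j k} → adj G i j ≡ true → adj G i k ≡ true → j ≡ k

MaxDeg1⇒degree≤1 : MaxDeg1 G → ∀ i → degree G i ≤ 1
MaxDeg1⇒degree≤1 {G} md i with isolated-or-adj {G} i
... | inj₁ d≡0      = ≤-trans (≤-reflexive d≡0) z≤n
... | inj₂ (j , ij) = subst (_≤ 1) (sym (degree≡∣neighbours∣ G i))
  (≤-trans (p⊆q⇒∣p∣≤∣q∣ N⊆⁅j⁆) (≤-reflexive (∣⁅x⁆∣≡1 j)))
  where
  N⊆⁅j⁆ : neighbours G i ⊆ ⁅ j ⁆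
  N⊆⁅j⁆ k∈N = subst (_∈ ⁅ j ⁆) (md ij (∈-tabulate⁻ (adj G i) k∈N)) (x∈⁅x⁆ j)

degree≤1⇒MaxDeg1 : (∀ i → degree G i ≤ 1) → MaxDeg1 G
degree≤1⇒MaxDeg1 {G} deg≤1 {i} {j} {k} ij ik =
  decidable-stable (j ≟ k) (λ j≢k → <-irrefl refl (≤-trans (two-neighbours⇒2≤degree {G} ij ik j≢k) (deg≤1 i)))

MaxDeg1-InducedIn : InducedIn A G → MaxDeg1 G → MaxDeg1 A
MaxDeg1-InducedIn A≤G md ij ik = emb-inj (md (trans (emb-adj _ _) ij) (trans (emb-adj _ _) ik))
  where open InducedIn A≤G

positive : ℕ → Bool
positive zero    = false
positive (suc _) = true

nonIsolated : (G : Graph) → Subset (order G)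
nonIsolated G = Vec.tabulate (positive ∘ degree G)

0<degree⇒∈nonIsolated : ∀ {i} → 0 < degree G i → i ∈ nonIsolated G
0<degree⇒∈nonIsolated {G} {i} 0<d with degree G i | ∈-tabulate⁺ (positive ∘ degree G) {i}
... | suc _ | ∈S = ∈S refl

∈nonIsolated⇒0<degree : ∀ {i} → i ∈ nonIsolated G → 0 < degree G i
∈nonIsolated⇒0<degree {G} {i} i∈S with degree G i | ∈-tabulate⁻ (positive ∘ degree G) i∈S
... | suc _ | _ = s≤s z≤n

adj⇒∈nonIsolated : ∀ {i j} → adj G i j ≡ true → i ∈ nonIsolated G
adj⇒∈nonIsolated {G} = 0<degree⇒∈nonIsolated {G} ∘ adj⇒0<degree {G}

∈nonIsolated⇒adj : ∀ {i} → i ∈ nonIsolated G → ∃ λ j → adj G i j ≡ true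
∈nonIsolated⇒adj {G} = 0<degree⇒adj {G} ∘ ∈nonIsolated⇒0<degree {G}

neighbours⊆nonIsolated-self : ∀ i → neighbours G i ⊆ nonIsolated G - i
neighbours⊆nonIsolated-self {G} i {k} k∈N =
  x∈p∧x≢y⇒x∈p-y (adj⇒∈nonIsolated {G} ki) (adj⇒≢ {G} ki)
  where
  ki : adj G k i ≡ true
  ki = trans (adj-sym G k i) (∈-tabulate⁻ (adj G i) k∈N)

NonIsolatedClique : Graph → Set
NonIsolatedClique G = ∀ {i j} → i ∈ nonIsolated G → j ∈ nonIsolated G → i ≢ j → adj G i j ≡ true

NonIsolatedClique⇒suc-degree : NonIsolatedClique G → ∀ {i} → i ∈ nonIsolated G →
                               suc (degree G i) ≡ ∣ nonIsolated G ∣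
NonIsolatedClique⇒suc-degree {G} clique {i} i∈S = begin
  suc (degree G i)           ≡⟨ cong suc (degree≡∣neighbours∣ G i) ⟩
  suc ∣ neighbours G i ∣     ≡⟨ cong suc (≤-antisym (p⊆q⇒∣p∣≤∣q∣ (neighbours⊆nonIsolated-self {G} i))
                                                    (p⊆q⇒∣p∣≤∣q∣ S-i⊆N)) ⟩
  suc ∣ nonIsolated G - i ∣  ≡⟨ suc∣p-x∣≡∣p∣ i∈S ⟩
  ∣ nonIsolated G ∣          ∎
  where
  open ≡-Reasoning
  S-i⊆N : nonIsolated G - i ⊆ neighbours G i
  S-i⊆N {j} j∈S-i = ∈-tabulate⁺ (adj G i)
    (clique i∈S (p─q⊆p _ _ j∈S-i) (λ { refl → x∉p-x j∈S-i }))

suc-degree⇒NonIsolatedClique : (∀ {i} → i ∈ nonIsolated G → suc (degree G i) ≡ ∣ nonIsolated G ∣) →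
                               NonIsolatedClique G
suc-degree⇒NonIsolatedClique {G} suc-degree {i} {j} i∈S j∈S i≢j with adj G i j in ij
... | true  = refl
... | false = ⊥-elim (<-irrefl degree≡∣S-i∣ degree<∣S-i∣)
  where
  degree≡∣S-i∣ : degree G i ≡ ∣ nonIsolated G - i ∣
  degree≡∣S-i∣ = suc-injective (trans (suc-degree i∈S) (sym (suc∣p-x∣≡∣p∣ i∈S)))
  N⊆S-i-j : neighbours G i ⊆ nonIsolated G - i - j
  N⊆S-i-j {k} k∈N = x∈p∧x≢y⇒x∈p-y (neighbours⊆nonIsolated-self {G} i k∈N)
    (λ { refl → case trans (sym ij) (∈-tabulate⁻ (adj G i) k∈N) of λ () })
  degree<∣S-i∣ : degree G i < ∣ nonIsolated G - i ∣
  degree<∣S-i∣ = subst (_< ∣ nonIsolated G - i ∣) (sym (degree≡∣neighbours∣ G i))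
    (≤-<-trans (p⊆q⇒∣p∣≤∣q∣ N⊆S-i-j) (x∈p⇒∣p-x∣<∣p∣ (x∈p∧x≢y⇒x∈p-y j∈S (i≢j ∘ sym))))

-- Degree sequences

degSeq≡tabulate : ∀ G → degSeq G ≡ List.tabulate (degree G)
degSeq≡tabulate G = map-tabulate (λ i → i) (degree G)

degree-permutation : SameDegSeq G G' →
  Σ (Permutation (order G) (order G')) λ π → ∀ i → degree G' (π ⟨$⟩ʳ i) ≡ degree G i
degree-permutation {G} {G'} same =
  tabulate-↭⇒permutation (subst₂ _↭_ (degSeq≡tabulate G) (degSeq≡tabulate G') same)

degree-transfer : SameDegSeq G G' → (P : ℕ → Set) → (∀ i → P (degree G i)) → ∀ i → P (degree G' i)
degree-transfer {G} {G'} same P P-deg i =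
  subst P (trans (sym (deg (π ⟨$⟩ˡ i))) (cong (degree G') (inverseʳ π))) (P-deg (π ⟨$⟩ˡ i))
  where open Σ (degree-permutation {G} {G'} same) renaming (proj₁ to π; proj₂ to deg)

SameDegSeq⇒order≡ : SameDegSeq G G' → order G ≡ order G'
SameDegSeq⇒order≡ {G} {G'} = ↔⇒≡ ∘ proj₁ ∘ degree-permutation {G} {G'}

∣nonIsolated∣≡sum : ∀ G → ∣ nonIsolated G ∣ ≡ sum (List.map (λ d → if positive d then 1 else 0) (degSeq G))
∣nonIsolated∣≡sum G = begin
  ∣ nonIsolated G ∣                                     ≡⟨ ∣tabulate∣≡sum (positive ∘ degree G) ⟩
  sum (List.tabulate (indicator ∘ degree G))            ≡⟨ cong sum (map-tabulate (degree G) indicator) ⟨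
  sum (List.map indicator (List.tabulate (degree G)))   ≡⟨ cong (sum ∘ List.map indicator) (degSeq≡tabulate G) ⟨
  sum (List.map indicator (degSeq G))                   ∎
  where
  open ≡-Reasoning
  indicator : ℕ → ℕ
  indicator d = if positive d then 1 else 0

∣nonIsolated∣-invariant : SameDegSeq G G' → ∣ nonIsolated G ∣ ≡ ∣ nonIsolated G' ∣
∣nonIsolated∣-invariant {G} {G'} same =
  trans (∣nonIsolated∣≡sum G) (trans (sum-↭ (map⁺ _ same)) (sym (∣nonIsolated∣≡sum G')))

MaxDeg1-invariant : SameDegSeq G G' → MaxDeg1 G → MaxDeg1 G'
MaxDeg1-invariant {G} {G'} same md =
  degree≤1⇒MaxDeg1 {G'} (degree-transfer {G} {G'} same (_≤ 1) (MaxDeg1⇒degree≤1 {G} md))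

NonIsolatedClique-invariant : SameDegSeq G G' → NonIsolatedClique G → NonIsolatedClique G'
NonIsolatedClique-invariant {G} {G'} same clique = suc-degree⇒NonIsolatedClique {G'} λ {i} i∈S →
  subst (λ c → suc (degree G' i) ≡ c) (∣nonIsolated∣-invariant {G} {G'} same)
        (degree-transfer {G} {G'} same P P-deg i (∈nonIsolated⇒0<degree {G'} i∈S))
  where
  P : ℕ → Set
  P d = 0 < d → suc d ≡ ∣ nonIsolated G ∣
  P-deg : ∀ i → P (degree G i)
  P-deg i 0<d = NonIsolatedClique⇒suc-degree {G} clique (0<degree⇒∈nonIsolated {G} 0<d)

NonIsolatedClique-induced : SameDegSeq G G' → NonIsolatedClique G → NonIsolatedClique G' → InducedIn G' G
NonIsolatedClique-induced {G} {G'} same clique clique' = mkInduced σ σ-≢ σ-adj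
  where
  open Σ (degree-permutation {G'} {G} (↭-sym same)) renaming (proj₁ to π; proj₂ to deg)
  σ : Fin (order G') → Fin (order G)
  σ i = π ⟨$⟩ʳ i
  σ-≢ : ∀ {i j} → i ≢ j → σ i ≢ σ j
  σ-≢ i≢j σi≡σj = i≢j (trans (sym (inverseˡ π)) (trans (cong (π ⟨$⟩ˡ_) σi≡σj) (inverseˡ π)))
  isolated : ∀ {i} j → degree G' i ≡ 0 → adj G (σ i) (σ j) ≡ adj G' i j
  isolated {i} j d≡0 = trans (degree≡0⇒¬adj {G} (σ j) (trans (deg i) d≡0)) (sym (degree≡0⇒¬adj {G'} j d≡0))
  σ-∈ : ∀ {i} → i ∈ nonIsolated G' → σ i ∈ nonIsolated G
  σ-∈ {i} i∈S = 0<degree⇒∈nonIsolated {G} (subst (0 <_) (sym (deg i)) (∈nonIsolated⇒0<degree {G'} i∈S))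
  σ-adj : ∀ i j → adj G (σ i) (σ j) ≡ adj G' i j
  σ-adj i j with i ≟ j | isolated-or-adj {G'} i | isolated-or-adj {G'} j
  ... | yes refl | _ | _ = trans (irrefl G (σ i)) (sym (irrefl G' i))
  ... | no _ | inj₁ d≡0 | _ = isolated j d≡0
  ... | no _ | _ | inj₁ d≡0 = trans (adj-sym G (σ i) (σ j)) (trans (isolated i d≡0) (adj-sym G' j i))
  ... | no i≢j | inj₂ (_ , ik) | inj₂ (_ , jl) =
    trans (clique (σ-∈ i∈S) (σ-∈ j∈S) (σ-≢ i≢j)) (sym (clique' i∈S j∈S i≢j))
    where
    i∈S = adj⇒∈nonIsolated {G'} ik
    j∈S = adj⇒∈nonIsolated {G'} jl

-- Complements

complement-adj⁻ : ∀ {i j} → adj (complement G) i j ≡ true → i ≢ j × adj G i j ≡ false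
complement-adj⁻ {G} {i} {j} coij with i ≟ j | adj G i j
... | no i≢j | false = i≢j , refl

complement-adj⁺ : ∀ {i j} → i ≢ j → adj G i j ≡ false → adj (complement G) i j ≡ true
complement-adj⁺ {G} {i} {j} i≢j ij rewrite dec-false (i ≟ j) i≢j | ij = refl

suc-degree-complement : ∀ G i → suc (degree (complement G) i) ≡ order G ∸ degree G i
suc-degree-complement G i = begin
  suc (degree (complement G) i)        ≡⟨ cong suc (trans (degree≡∣neighbours∣ (complement G) i)
                                            (≤-antisym (p⊆q⇒∣p∣≤∣q∣ coN⊆∁N-i) (p⊆q⇒∣p∣≤∣q∣ ∁N-i⊆coN))) ⟩
  suc ∣ ∁ (neighbours G i) - i ∣       ≡⟨ suc∣p-x∣≡∣p∣ (x∉p⇒x∈∁p i∉N) ⟩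
  ∣ ∁ (neighbours G i) ∣               ≡⟨ ∣∁p∣≡n∸∣p∣ (neighbours G i) ⟩
  order G ∸ ∣ neighbours G i ∣         ≡⟨ cong (order G ∸_) (degree≡∣neighbours∣ G i) ⟨
  order G ∸ degree G i                 ∎
  where
  open ≡-Reasoning
  i∉N : i ∉ neighbours G i
  i∉N i∈N = case trans (sym (∈-tabulate⁻ (adj G i) i∈N)) (irrefl G i) of λ ()
  coN⊆∁N-i : neighbours (complement G) i ⊆ ∁ (neighbours G i) - i
  coN⊆∁N-i j∈coN with i≢j , ij ← complement-adj⁻ {G} (∈-tabulate⁻ (adj (complement G) i) j∈coN) =
    x∈p∧x≢y⇒x∈p-y (x∉p⇒x∈∁p λ j∈N → case trans (sym (∈-tabulate⁻ (adj G i) j∈N)) ij of λ ()) (i≢j ∘ sym)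
  ∁N-i⊆coN : ∁ (neighbours G i) - i ⊆ neighbours (complement G) i
  ∁N-i⊆coN j∈∁N-i = ∈-tabulate⁺ (adj (complement G) i)
    (complement-adj⁺ {G} (λ { refl → x∉p-x j∈∁N-i }) (∉neighbours⇒¬adj {G} (x∈∁p⇒x∉p (p─q⊆p _ _ j∈∁N-i))))

degSeq-complement : ∀ G → degSeq (complement G) ≡ List.map (λ d → pred (order G ∸ d)) (degSeq G)
degSeq-complement G = begin
  degSeq (complement G)                                       ≡⟨ degSeq≡tabulate (complement G) ⟩
  List.tabulate (degree (complement G))                       ≡⟨ tabulate-cong (cong pred ∘ suc-degree-complement G) ⟩
  List.tabulate (λ i → pred (order G ∸ degree G i))           ≡⟨ map-tabulate (degree G) _ ⟨
  List.map (λ d → pred (order G ∸ d)) (List.tabulate (degree G)) ≡⟨ cong (List.map _) (degSeq≡tabulate G) ⟨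
  List.map (λ d → pred (order G ∸ d)) (degSeq G)              ∎
  where open ≡-Reasoning

complement-SameDegSeq : SameDegSeq G G' → SameDegSeq (complement G) (complement G')
complement-SameDegSeq {G} {G'} same = subst₂ _↭_ (sym (degSeq-complement G))
  (trans (cong (λ n → List.map (λ d → pred (n ∸ d)) (degSeq G')) (SameDegSeq⇒order≡ {G} {G'} same))
         (sym (degSeq-complement G')))
  (map⁺ _ same)

complement-InducedIn : InducedIn H G → InducedIn (complement H) (complement G)
complement-InducedIn H≤G = record
  { emb     = emb
  ; emb-inj = emb-inj
  ; emb-adj = λ i j → cong₂ (λ a b → not a ∧ not b) (==-injective emb-inj i j) (emb-adj i j)
  }
  where open InducedIn H≤G

complement²-adj : ∀ G i j → adj (complement (complement G)) i j ≡ adj G i j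
complement²-adj G i j with i ≟ j
... | yes refl = sym (irrefl G i)
... | no _     = not-involutive (adj G i j)

InducedIn-complement² : InducedIn G (complement (complement G))
InducedIn-complement² {G} = mkInduced (λ i → i) (λ i≢j → i≢j) (complement²-adj G)

complement²-InducedIn : InducedIn (complement (complement G)) G
complement²-InducedIn {G} = mkInduced (λ i → i) (λ i≢j → i≢j) (λ i j → sym (complement²-adj G i j))

-- Cluster graphs

Cluster : Graph → Set
Cluster G = ∀ {u v w} → adj G u v ≡ true → adj G v w ≡ true → u ≢ w → adj G u w ≡ true

P3-free⇒Cluster : ¬ InducedIn P3 G → Cluster G
P3-free⇒Cluster {G} P3∉G {u} {v} {w} uv vw u≢w with adj G u w in uw
... | true  = refl
... | false = ⊥-elim (P3∉G (mkInduced f f-≢ f-adj))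
  where
  f : Fin 3 → Fin (order G)
  f zero             = u
  f (suc zero)       = v
  f (suc (suc zero)) = w
  vu = trans (adj-sym G v u) uv
  f-≢ : ∀ {i j} → i ≢ j → f i ≢ f j
  f-≢ {zero}             {zero}             i≢j = ⊥-elim (i≢j refl)
  f-≢ {zero}             {suc zero}         _   = adj⇒≢ {G} uv
  f-≢ {zero}             {suc (suc zero)}   _   = u≢w
  f-≢ {suc zero}         {zero}             _   = adj⇒≢ {G} vu
  f-≢ {suc zero}         {suc zero}         i≢j = ⊥-elim (i≢j refl)
  f-≢ {suc zero}         {suc (suc zero)}   _   = adj⇒≢ {G} vw
  f-≢ {suc (suc zero)}   {zero}             _   = u≢w ∘ sym
  f-≢ {suc (suc zero)}   {suc zero}         _   = adj⇒≢ {G} vw ∘ sym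
  f-≢ {suc (suc zero)}   {suc (suc zero)}   i≢j = ⊥-elim (i≢j refl)
  f-adj : ∀ i j → adj G (f i) (f j) ≡ adj P3 i j
  f-adj zero             zero             = irrefl G u
  f-adj zero             (suc zero)       = uv
  f-adj zero             (suc (suc zero)) = uw
  f-adj (suc zero)       zero             = vu
  f-adj (suc zero)       (suc zero)       = irrefl G v
  f-adj (suc zero)       (suc (suc zero)) = vw
  f-adj (suc (suc zero)) zero             = trans (adj-sym G w u) uw
  f-adj (suc (suc zero)) (suc zero)       = trans (adj-sym G w v) vw
  f-adj (suc (suc zero)) (suc (suc zero)) = irrefl G w

Cluster⇒P3-free : Cluster G → ¬ InducedIn P3 G
Cluster⇒P3-free cluster P3≤G =
  case trans (sym (cluster (emb-adj zero (suc zero)) (emb-adj (suc zero) (suc (suc zero)))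
                           (λ e → case emb-inj e of λ ())))
             (emb-adj zero (suc (suc zero))) of λ ()
  where open InducedIn P3≤G

MaxDeg1⇒Cluster : MaxDeg1 G → Cluster G
MaxDeg1⇒Cluster {G} md {u} {v} {w} uv vw u≢w = ⊥-elim (u≢w (md (trans (adj-sym G v u) uv) vw))

ClosedNbr : (G : Graph) → Fin (order G) → Fin (order G) → Set
ClosedNbr G v a = a ≡ v ⊎ adj G v a ≡ true

ClosedNbr? : ∀ G v a → Dec (ClosedNbr G v a)
ClosedNbr? G v a = (a ≟ v) ⊎-dec (adj G v a Bool.≟ true)

module _ (cluster : Cluster G) {v : Fin (order G)} where

  ClosedNbr-adj : ∀ {a b} → ClosedNbr G v a → ClosedNbr G v b → a ≢ b → adj G a b ≡ true
  ClosedNbr-adj (inj₁ refl) (inj₁ refl) a≢b = ⊥-elim (a≢b refl)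
  ClosedNbr-adj (inj₁ refl) (inj₂ vb)   _   = vb
  ClosedNbr-adj (inj₂ va)   (inj₁ refl) _   = trans (adj-sym G _ v) va
  ClosedNbr-adj (inj₂ va)   (inj₂ vb)   a≢b = cluster (trans (adj-sym G _ v) va) vb a≢b

  ClosedNbr-closed : ∀ {a b} → ClosedNbr G v b → adj G a b ≡ true → ClosedNbr G v a
  ClosedNbr-closed {a} (inj₁ refl) ab = inj₂ (trans (adj-sym G v a) ab)
  ClosedNbr-closed {a} (inj₂ vb)   ab with a ≟ v
  ... | yes a≡v = inj₁ a≡v
  ... | no  a≢v = inj₂ (trans (adj-sym G v a) (cluster ab (trans (adj-sym G _ v) vb) a≢v))

  ClosedNbr-separated : ∀ {a b} → ClosedNbr G v a → ¬ ClosedNbr G v b → adj G a b ≡ false × a ≢ b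
  ClosedNbr-separated {a} {b} a∈N b∉N with adj G a b in ab
  ... | true  = ⊥-elim (b∉N (ClosedNbr-closed a∈N (trans (adj-sym G b a) ab)))
  ... | false = refl , λ { refl → b∉N a∈N }

  Cluster-⊕-induced : ∀ {m n} {f : Fin m → Fin (order G)} {g : Fin n → Fin (order G)} →
    Clique G f → Clique G g → (∀ i → ClosedNbr G v (f i)) → (∀ j → ¬ ClosedNbr G v (g j)) →
    InducedIn (K m ⊕ K n) G
  Cluster-⊕-induced {m} {n} {f} {g} f-clique g-clique f∈N g∉N = record
    { emb     = e ∘ splitAt m
    ; emb-inj = λ {k} {l} ek≡el →
        trans (sym (join-splitAt m n k))
              (trans (cong (join m n) (e-injective (splitAt m k) (splitAt m l) ek≡el)) (join-splitAt m n l))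
    ; emb-adj = λ k l → e-adj (splitAt m k) (splitAt m l)
    }
    where
    e : Fin m ⊎ Fin n → Fin (order G)
    e = [ f , g ]
    e-injective : ∀ x y → e x ≡ e y → x ≡ y
    e-injective (inj₁ i) (inj₁ j) fi≡fj = cong inj₁ (Clique⇒injective {G} f-clique fi≡fj)
    e-injective (inj₂ i) (inj₂ j) gi≡gj = cong inj₂ (Clique⇒injective {G} g-clique gi≡gj)
    e-injective (inj₁ i) (inj₂ j) fi≡gj = ⊥-elim (proj₂ (ClosedNbr-separated (f∈N i) (g∉N j)) fi≡gj)
    e-injective (inj₂ i) (inj₁ j) gi≡fj = ⊥-elim (proj₂ (ClosedNbr-separated (f∈N j) (g∉N i)) (sym gi≡fj))
    clique-adj : ∀ {p} {h : Fin p → Fin (order G)} → Clique G h → ∀ i j → adj G (h i) (h j) ≡ not (i == j)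
    clique-adj {h = h} h-clique i j with i ≟ j
    ... | yes refl = irrefl G (h i)
    ... | no  i≢j  = h-clique i≢j
    e-adj : ∀ x y → adj G (e x) (e y) ≡ adj⊎ (K m) (K n) x y
    e-adj (inj₁ i) (inj₁ j) = clique-adj f-clique i j
    e-adj (inj₂ i) (inj₂ j) = clique-adj g-clique i j
    e-adj (inj₁ i) (inj₂ j) = proj₁ (ClosedNbr-separated (f∈N i) (g∉N j))
    e-adj (inj₂ i) (inj₁ j) = trans (adj-sym G (g i) (f j)) (proj₁ (ClosedNbr-separated (f∈N j) (g∉N i)))

  edge-outside : ∀ {z z'} → ¬ ClosedNbr G v z → adj G z z' ≡ true → ∀ j → ¬ ClosedNbr G v (pair z z' j)
  edge-outside z∉N zz' zero       = z∉N
  edge-outside z∉N zz' (suc zero) = λ z'∈N → z∉N (ClosedNbr-closed z'∈N zz')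

  nonadjacent-outside : ∀ {u w} → u ≢ w → adj G u w ≡ false → ¬ ClosedNbr G v u ⊎ ¬ ClosedNbr G v w
  nonadjacent-outside {u} {w} u≢w uw with ClosedNbr? G v u
  ... | no  u∉N = inj₁ u∉N
  ... | yes u∈N = inj₂ λ w∈N → case trans (sym uw) (ClosedNbr-adj u∈N w∈N u≢w) of λ ()

  K3⊕K2-around : ∀ {x y z z'} → adj G v x ≡ true → adj G v y ≡ true → x ≢ y →
                 ¬ ClosedNbr G v z → adj G z z' ≡ true → InducedIn (K 3 ⊕ K 2) G
  K3⊕K2-around {x} {y} vx vy x≢y z∉N zz' =
    Cluster-⊕-induced triangle (edge-Clique {G} zz') triangle∈N (edge-outside z∉N zz')
    where
    triangle∈N : ∀ i → ClosedNbr G v (triple v x y i)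
    triangle∈N zero             = inj₁ refl
    triangle∈N (suc zero)       = inj₂ vx
    triangle∈N (suc (suc zero)) = inj₂ vy
    triangle : Clique G (triple v x y)
    triangle i≢j = ClosedNbr-adj (triangle∈N _) (triangle∈N _)
                     (triple-≢ (adj⇒≢ {G} vx) (adj⇒≢ {G} vy) x≢y i≢j)

  K2⊕K2-around : ∀ {v' w w'} → adj G v v' ≡ true → adj G w w' ≡ true → ¬ ClosedNbr G v w →
                 InducedIn (K 2 ⊕ K 2) G
  K2⊕K2-around vv' ww' w∉N =
    Cluster-⊕-induced (edge-Clique {G} vv') (edge-Clique {G} ww') edge∈N (edge-outside w∉N ww')
    where
    edge∈N : ∀ i → ClosedNbr G v (pair v _ i)
    edge∈N zero       = inj₁ refl
    edge∈N (suc zero) = inj₂ vv'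

TwoNeighbours : Graph → Set
TwoNeighbours G = ∃ λ v → ∃ λ x → ∃ λ y → adj G v x ≡ true × adj G v y ≡ true × x ≢ y

¬TwoNeighbours⇒MaxDeg1 : ¬ TwoNeighbours G → MaxDeg1 G
¬TwoNeighbours⇒MaxDeg1 ¬two {i} {j} {k} ij ik =
  decidable-stable (j ≟ k) (λ j≢k → ¬two (i , j , k , ij , ik , j≢k))

-- Doubly negated because the case split on whether some vertex has two neighbours is not
-- constructive; every use of it proves ⊥.
Cluster-structure : Cluster G → ¬ InducedIn (K 3 ⊕ K 2) G →
                    ¬ ¬ (NonIsolatedClique G ⊎ (MaxDeg1 G × InducedIn (K 2 ⊕ K 2) G))
Cluster-structure {G} cluster K3⊕K2∉G ¬structure = ¬structure (inj₁ clique)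
  where
  clique : NonIsolatedClique G
  clique {u} {w} u∈S w∈S u≢w with adj G u w in uw
  ... | true  = refl
  ... | false = ⊥-elim (matching two-neighbours)
    where
    uu' = proj₂ (∈nonIsolated⇒adj {G} u∈S)
    ww' = proj₂ (∈nonIsolated⇒adj {G} w∈S)
    two-neighbours : ¬ TwoNeighbours G
    two-neighbours (v , x , y , vx , vy , x≢y) with nonadjacent-outside {G} cluster {v} u≢w uw
    ... | inj₁ u∉N = K3⊕K2∉G (K3⊕K2-around {G} cluster vx vy x≢y u∉N uu')
    ... | inj₂ w∉N = K3⊕K2∉G (K3⊕K2-around {G} cluster vx vy x≢y w∉N ww')
    w∉N[u] : ¬ ClosedNbr G u w
    w∉N[u] (inj₁ w≡u) = u≢w (sym w≡u)
    w∉N[u] (inj₂ uw') = case trans (sym uw) uw' of λ ()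
    matching : ¬ ¬ TwoNeighbours G
    matching ¬two =
      ¬structure (inj₂ (¬TwoNeighbours⇒MaxDeg1 {G} ¬two , K2⊕K2-around {G} cluster uu' ww' w∉N[u]))

P3∉K3⊕K2 : ¬ InducedIn P3 (K 3 ⊕ K 2)
P3∉K3⊕K2 = Cluster⇒P3-free (λ {u} {v} {w} → transitive u v w)
  where
  transitive : ∀ u v w → adj (K 3 ⊕ K 2) u v ≡ true → adj (K 3 ⊕ K 2) v w ≡ true → u ≢ w →
               adj (K 3 ⊕ K 2) u w ≡ true
  transitive = from-yes (all? λ u → all? λ v → all? λ w →
    (adj (K 3 ⊕ K 2) u v Bool.≟ true) →-dec (adj (K 3 ⊕ K 2) v w Bool.≟ true) →-dec ¬? (u ≟ w) →-dec
    (adj (K 3 ⊕ K 2) u w Bool.≟ true))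

avoids-triangle-vertex : MaxDeg1 A → (A≤ : InducedIn A (K 3 ⊕ H)) →
                         ∃ λ (t : Fin 3) → ∀ i → t ↑ˡ order H ≢ InducedIn.emb A≤ i
avoids-triangle-vertex {A} {H} md A≤ with hit zero | hit (suc zero) | hit (suc (suc zero))
  where
  open InducedIn A≤
  hit : ∀ t → Dec (∃ λ i → t ↑ˡ order H ≡ emb i)
  hit t = any? λ i → t ↑ˡ order H ≟ emb i
... | no miss | _ | _ = zero , λ i e → miss (i , e)
... | _ | no miss | _ = suc zero , λ i e → miss (i , e)
... | _ | _ | no miss = suc (suc zero) , λ i e → miss (i , e)
... | yes (i₀ , e₀) | yes (i₁ , e₁) | yes (i₂ , e₂) =
  case trans e₁ (trans (cong emb (md (adj-emb e₀ e₁) (adj-emb e₀ e₂))) (sym e₂)) of λ ()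
  where
  open InducedIn A≤
  adj-emb : ∀ {a b i j} → a ≡ emb i → b ≡ emb j → adj A i j ≡ adj (K 3 ⊕ H) a b
  adj-emb refl refl = sym (emb-adj _ _)

K3⊕K2-punchIn-triangle : ∀ (t : Fin 3) i j →
  adj (K 3 ⊕ K 2) (punchIn (t ↑ˡ 2) i) (punchIn (t ↑ˡ 2) j) ≡ adj (K 2 ⊕ K 2) i j
K3⊕K2-punchIn-triangle = from-yes (all? λ (t : Fin 3) → all? λ i → all? λ j →
  adj (K 3 ⊕ K 2) (punchIn (t ↑ˡ 2) i) (punchIn (t ↑ˡ 2) j) Bool.≟ adj (K 2 ⊕ K 2) i j)

MaxDeg1-K3⊕K2⇒K2⊕K2 : MaxDeg1 A → InducedIn A (K 3 ⊕ K 2) → InducedIn A (K 2 ⊕ K 2)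
MaxDeg1-K3⊕K2⇒K2⊕K2 {A} md A≤ = record
  { emb     = λ i → punchOut (avoid i)
  ; emb-inj = λ {i} {j} e → emb-inj (punchOut-injective (avoid i) (avoid j) e)
  ; emb-adj = λ i j → begin
      adj (K 2 ⊕ K 2) (punchOut (avoid i)) (punchOut (avoid j))
        ≡⟨ K3⊕K2-punchIn-triangle t _ _ ⟨
      adj (K 3 ⊕ K 2) (punchIn (t ↑ˡ 2) (punchOut (avoid i))) (punchIn (t ↑ˡ 2) (punchOut (avoid j)))
        ≡⟨ cong₂ (adj (K 3 ⊕ K 2)) (punchIn-punchOut (avoid i)) (punchIn-punchOut (avoid j)) ⟩
      adj (K 3 ⊕ K 2) (emb i) (emb j)
        ≡⟨ emb-adj i j ⟩
      adj A i j ∎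
  }
  where
  open InducedIn A≤
  open ≡-Reasoning
  t = proj₁ (avoids-triangle-vertex {A} {K 2} md A≤)
  avoid = proj₂ (avoids-triangle-vertex {A} {K 2} md A≤)

P3≤path5 : InducedIn P3 (path 5)
P3≤path5 = InducedIn-by-evaluation (_↑ˡ 2)

-- By evaluation the two degree sequences are 2,2,2,1,1 and 1,2,2,2,1.
K3⊕K2↭path5 : SameDegSeq (K 3 ⊕ K 2) (path 5)
K3⊕K2↭path5 = shift 1 (2 ∷ 2 ∷ 2 ∷ []) (1 ∷ [])

swap₀₁ : Fin 3 → Fin 3
swap₀₁ zero             = suc zero
swap₀₁ (suc zero)       = zero
swap₀₁ (suc (suc zero)) = suc (suc zero)

P3≤complement-K1+K2 : InducedIn P3 (complement K1+K2)
P3≤complement-K1+K2 = InducedIn-by-evaluation swap₀₁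

complement-K1+K2≤P3 : InducedIn (complement K1+K2) P3
complement-K1+K2≤P3 = InducedIn-by-evaluation swap₀₁

-- Degree-sequence-forcing sets

DSF-resp-↭ : ∀ {F F'} → F ↭ F' → DSF F → DSF F'
DSF-resp-↭ F↭F' dsf G G' same G-free = All-resp-↭ F↭F' (dsf G G' same (All-resp-↭ (↭-sym F↭F') G-free))

DSF-resp-head : InducedIn H H' → InducedIn H' H → ∀ {F} → DSF (H ∷ F) → DSF (H' ∷ F)
DSF-resp-head H≤H' H'≤H dsf G G' same (H'∉G ∷ F-free)
  with H∉G' ∷ F-free' ← dsf G G' same ((λ H≤G → H'∉G (InducedIn-trans H'≤H H≤G)) ∷ F-free)
  = (λ H'≤G' → H∉G' (InducedIn-trans H≤H' H'≤G')) ∷ F-free'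

DSF-complement : ∀ {F} → DSF F → DSF (List.map complement F)
DSF-complement dsf G G' same G-free = All.map⁺ (All.map
  (λ H∉coG' coH≤G' → H∉coG' (InducedIn-trans InducedIn-complement² (complement-InducedIn coH≤G')))
  (dsf (complement G) (complement G') (complement-SameDegSeq {G} {G'} same) (All.map
    (λ coH∉G H≤coG → coH∉G (InducedIn-trans (complement-InducedIn H≤coG) complement²-InducedIn))
    (All.map⁻ G-free))))

DSF-complement⁻ : ∀ {F} → DSF (List.map complement F) → DSF F
DSF-complement⁻ dsf G G' same G-free = All.map
  (λ coH∉coG' H≤G' → coH∉coG' (complement-InducedIn H≤G'))
  (All.map⁻ (dsf (complement G) (complement G') (complement-SameDegSeq {G} {G'} same) (All.map⁺ (All.map
    (λ H∉G coH≤coG → H∉G (InducedIn-trans InducedIn-complement²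
                            (InducedIn-trans (complement-InducedIn coH≤coG) complement²-InducedIn)))
    G-free))))

order≡1⇒DSF : order H ≡ 1 → DSF (H ∷ [])
order≡1⇒DSF {H} e G G' same (H∉G ∷ []) = H∉G' ∷ []
  where
  single : ∀ {X : Set} {i j : Fin (order H)} → i ≢ j → X
  single {i = i} {j} i≢j = ⊥-elim (i≢j (Fin1-unique e i j))
  G-empty : ¬ Fin (order G)
  G-empty v = H∉G (complete-InducedIn {H} {G} single (λ _ → v) single)
  H∉G' : ¬ InducedIn H G'
  H∉G' H≤G' = G-empty (subst Fin (sym (SameDegSeq⇒order≡ {G} {G'} same))
                                 (InducedIn.emb H≤G' (subst Fin (sym e) zero)))

order≡2-edge⇒DSF : order H ≡ 2 → ∀ {x y} → x ≢ y → adj H x y ≡ true → DSF (H ∷ [])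
order≡2-edge⇒DSF {H} e {x} {y} x≢y xy G G' same (H∉G ∷ []) = H∉G' ∷ []
  where
  H-complete : ∀ {i j} → i ≢ j → adj H i j ≡ true
  H-complete = Fin2-symmetric e x≢y (λ i j → adj H i j ≡ true) xy (trans (adj-sym H y x) xy)
  G-edgeless : ∀ u v → adj G u v ≡ false
  G-edgeless u v with adj G u v in uv
  ... | false = refl
  ... | true  = ⊥-elim (H∉G (complete-InducedIn {H} {G} H-complete f f-clique))
    where
    f : Fin (order H) → Fin (order G)
    f i = if i == x then u else v
    fx≡u : f x ≡ u
    fx≡u = cong (λ b → if b then u else v) (==-refl x)
    fy≡v : f y ≡ v
    fy≡v = cong (λ b → if b then u else v) (dec-false (y ≟ x) (x≢y ∘ sym))
    f-clique : Clique G f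
    f-clique = Fin2-symmetric e x≢y (λ i j → adj G (f i) (f j) ≡ true)
      (subst₂ (λ a b → adj G a b ≡ true) (sym fx≡u) (sym fy≡v) uv)
      (subst₂ (λ a b → adj G a b ≡ true) (sym fy≡v) (sym fx≡u) (trans (adj-sym G v u) uv))
  G-isolated : ∀ i → degree G i ≡ 0
  G-isolated i with isolated-or-adj {G} i
  ... | inj₁ d≡0     = d≡0
  ... | inj₂ (j , ij) = case trans (sym ij) (G-edgeless i j) of λ ()
  H∉G' : ¬ InducedIn H G'
  H∉G' H≤G' = case trans (sym xy) (trans (sym (emb-adj x y)) (degree≡0⇒¬adj {G'} (emb y) G'-isolated)) of λ ()
    where
    open InducedIn H≤G'
    G'-isolated = degree-transfer {G} {G'} same (_≡ 0) G-isolated (emb x)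

order≡2⇒DSF : order H ≡ 2 → DSF (H ∷ [])
order≡2⇒DSF {H} e with Fin2-distinct e
... | x , y , x≢y with adj H x y in xy
...   | true  = order≡2-edge⇒DSF e x≢y xy
...   | false = DSF-complement⁻ (order≡2-edge⇒DSF {complement H} e x≢y (complement-adj⁺ {H} x≢y xy))

P3-pair-DSF : InducedIn A (K 3 ⊕ K 2) → DSF (P3 ∷ A ∷ [])
P3-pair-DSF {A} A≤K3⊕K2 G G' same (P3∉G ∷ A∉G ∷ []) = P3∉G' ∷ A∉G' ∷ []
  where
  transfer : ∀ {H} → ¬ InducedIn H G → (MaxDeg1 G' → InducedIn (K 2 ⊕ K 2) G → ¬ InducedIn H G') →
             ¬ InducedIn H G'
  transfer H∉G matching H≤G' =
    Cluster-structure {G} (P3-free⇒Cluster {G} P3∉G) (A∉G ∘ InducedIn-trans A≤K3⊕K2) λ where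
      (inj₁ clique) → H∉G (InducedIn-trans H≤G' (NonIsolatedClique-induced {G} {G'} same clique
                                                   (NonIsolatedClique-invariant {G} {G'} same clique)))
      (inj₂ (md , K2⊕K2≤G)) → matching (MaxDeg1-invariant {G} {G'} same md) K2⊕K2≤G H≤G'
  P3∉G' : ¬ InducedIn P3 G'
  P3∉G' = transfer P3∉G λ md' _ → Cluster⇒P3-free (MaxDeg1⇒Cluster {G'} md')
  A∉G' : ¬ InducedIn A G'
  A∉G' = transfer A∉G λ md' K2⊕K2≤G A≤G' →
    A∉G (InducedIn-trans (MaxDeg1-K3⊕K2⇒K2⊕K2 (MaxDeg1-InducedIn A≤G' md') A≤K3⊕K2) K2⊕K2≤G)

P3∉minimal-triple : DSF (P3 ∷ A ∷ B ∷ []) → ¬ DSF (P3 ∷ A ∷ []) → ¬ DSF (P3 ∷ B ∷ []) → ⊥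
P3∉minimal-triple dsf ¬A ¬B
  with P3∉path5 ∷ _ ← dsf (K 3 ⊕ K 2) (path 5) K3⊕K2↭path5
         (P3∉K3⊕K2 ∷ ¬A ∘ P3-pair-DSF ∷ ¬B ∘ P3-pair-DSF ∷ [])
  = P3∉path5 P3≤path5

minimal-member : DSF (H ∷ A ∷ B ∷ []) → ¬ DSF (H ∷ []) → ¬ DSF (H ∷ A ∷ []) → ¬ DSF (H ∷ B ∷ []) →
                 (¬ (order H ≡ 1 ⊎ order H ≡ 2)) × (¬ (H ≅ P3)) × (¬ (H ≅ K1+K2))
minimal-member {H} dsf ¬H ¬HA ¬HB = small , not-P3 , not-K1+K2
  where
  small : ¬ (order H ≡ 1 ⊎ order H ≡ 2)
  small (inj₁ e) = ¬H (order≡1⇒DSF e)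
  small (inj₂ e) = ¬H (order≡2⇒DSF e)
  not-P3 : ¬ (H ≅ P3)
  not-P3 φ = P3∉minimal-triple (DSF-resp-head H≤P3 P3≤H dsf)
               (¬HA ∘ DSF-resp-head P3≤H H≤P3) (¬HB ∘ DSF-resp-head P3≤H H≤P3)
    where
    H≤P3 = ≅⇒InducedIn φ
    P3≤H = ≅⇒InducedIn (≅-sym φ)
  not-K1+K2 : ¬ (H ≅ K1+K2)
  not-K1+K2 φ = P3∉minimal-triple (DSF-resp-head coH≤P3 P3≤coH (DSF-complement dsf))
                  (¬HA ∘ DSF-complement⁻ ∘ DSF-resp-head P3≤coH coH≤P3)
                  (¬HB ∘ DSF-complement⁻ ∘ DSF-resp-head P3≤coH coH≤P3)
    where
    coH≤P3 = InducedIn-trans (complement-InducedIn (≅⇒InducedIn φ)) complement-K1+K2≤P3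
    P3≤coH = InducedIn-trans P3≤complement-K1+K2 (complement-InducedIn (≅⇒InducedIn (≅-sym φ)))

lemma3p3 : (F₁ F₂ F₃ : Graph) → MinimalDSFTriple F₁ F₂ F₃ →
    All (λ H → (¬ (order H ≡ 1 ⊎ order H ≡ 2)) × (¬ (H ≅ P3)) × (¬ (H ≅ K1+K2)))
      (F₁ ∷ F₂ ∷ F₃ ∷ [])
lemma3p3 F₁ F₂ F₃ (_ , _ , _ , dsf , ¬1 , ¬2 , ¬3 , ¬12 , ¬13 , ¬23) =
  minimal-member dsf ¬1 ¬12 ¬13 ∷
  minimal-member (DSF-resp-↭ (swap F₁ F₂ ↭-refl) dsf) ¬2 (¬12 ∘ DSF-resp-↭ (swap F₂ F₁ ↭-refl)) ¬23 ∷
  minimal-member (DSF-resp-↭ (shift F₃ (F₁ ∷ F₂ ∷ []) []) dsf) ¬3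
    (¬13 ∘ DSF-resp-↭ (swap F₃ F₁ ↭-refl)) (¬23 ∘ DSF-resp-↭ (swap F₃ F₂ ↭-refl)) ∷ []
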